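{- Let $G$ be a 2-connected bipartite graph with no pairs of twins, and let $x,y,s,t$ be vertices with $\{x,y\}\neq\{s,t\}$, $d(x,y)=d(s,t)=2$ and $\overline{xy}^G=\overline{st}^G$. Then $\max\{d(x,s),d(x,t),d(y,s),d(y,t)\}\geq 4$. Moreover, if $d(y,t)=\max\{d(x,s),d(x,t),d(y,s),d(y,t)\}$, then $[yxst]$ holds.
   Context: Graphs are finite and simple; a graph is 2-connected if it is connected, has at least three vertices and no cut vertex. $d$ is the shortest-path distance. For distinct vertices $x,y$, $\overline{xy}^G=\{z: d(x,y)=d(x,z)+d(z,y)\ \text{or}\ d(x,y)=|d(x,z)-d(z,y)|\}$. A pair of twins is a pair $(v,v')$ of distinct vertices with $d(v,v')\neq 1$ and $d(v,u)=d(v',u)$ for every $u\notin\{v,v'\}$. For vertices $y,x,s,t$, $[yxst]$ holds if $d(y,t)=d(y,x)+d(x,t)=d(y,x)+d(x,s)+d(s,t)=d(y,s)+d(s,t)$. -}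

module Defs where

open import Data.Nat using (ℕ; zero; suc; _+_; _≤_; _⊔_)
open import Data.Fin using (Fin)
open import Data.Bool using (Bool)
open import Data.Unit using (⊤)
open import Data.Product using (Σ; _×_; ∃)
open import Data.Sum using (_⊎_)
open import Relation.Nullary using (¬_; Dec)
open import Relation.Binary.PropositionalEquality using (_≡_; _≢_)

record Graph : Set₁ where
  field
    n      : ℕ
    Adj    : Fin n → Fin n → Set
    sym    : ∀ {x y} → Adj x y → Adj y x
    irrefl : ∀ {x} → ¬ Adj x x
    dec    : ∀ x y → Dec (Adj x y)

module _ (G : Graph) where
  open Graph G

  V : Set
  V = Fin n

  data WalkIn (P : V → Set) : V → V → ℕ → Set where
    here : ∀ {x} → P x → WalkIn P x x zero
    step : ∀ {x y z k} → P x → Adj x y → WalkIn P y z k → WalkIn P x z (suc k)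

  Walk : V → V → ℕ → Set
  Walk = WalkIn (λ _ → ⊤)

  Connected : Set
  Connected = ∀ x y → ∃ λ k → Walk x y k

  TwoConnected : Set
  TwoConnected =
    (3 ≤ n) × Connected ×
    (∀ v x y → x ≢ v → y ≢ v → ∃ λ k → WalkIn (λ u → u ≢ v) x y k)

  Bipartite : Set
  Bipartite = Σ (V → Bool) λ c → ∀ {x y} → Adj x y → c x ≢ c y

  IsDistance : (V → V → ℕ) → Set
  IsDistance d = ∀ x y → Walk x y (d x y) × (∀ k → Walk x y k → d x y ≤ k)

module _ (G : Graph) (d : V G → V G → ℕ) where

  -- z ∈ \overline{xy}: d(x,y) = d(x,z)+d(z,y) or d(x,y) = |d(x,z) - d(z,y)|
  InLine : V G → V G → V G → Set
  InLine x y z =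
    (d x y ≡ d x z + d z y) ⊎ (d x y + d z y ≡ d x z) ⊎ (d x y + d x z ≡ d z y)

  SameLine : V G → V G → V G → V G → Set
  SameLine x y s t = ∀ z → (InLine x y z → InLine s t z) × (InLine s t z → InLine x y z)

  IsTwins : V G → V G → Set
  IsTwins v v' = v ≢ v' × d v v' ≢ 1 × (∀ u → u ≢ v → u ≢ v' → d v u ≡ d v' u)

  NoTwins : Set
  NoTwins = ∀ v v' → ¬ IsTwins v v'

  Between4 : V G → V G → V G → V G → Set
  Between4 y x s t =
    (d y t ≡ d y x + d x t) × (d y t ≡ d y x + d x s + d s t) × (d y t ≡ d y s + d s t)

-- For d(p,q) = 2 a vertex z lies on the line through p and q iff its
-- distance pair (d(z,p), d(z,q)) is (1,1), (n+2,n) or (n,n+2) (a LinePair).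
-- As s, t lie on the line xy and x, y on the line st, the four pairs
-- (d(x,s), d(y,s)), (d(x,t), d(y,t)), (d(x,s), d(x,t)), (d(y,s), d(y,t))
-- are LinePairs, and a finite case analysis (classify) leaves eleven
-- configurations.  In the four "far" ones some distance is 4 more than the
-- opposite one and the theorem is arithmetic (far-conclusion).  The other
-- seven are impossible (nondegenerate): distances (1,1,1,1) make x and y
-- twins; a crossed configuration (2+m, m, m, 2+m) forces m = 0, i.e.
-- {x,y} = {s,t}; distances 1, 1, 1, 3 make x a cut vertex, because the
-- invariant d(u,y) = d(u,x) + 2 persists along every path avoiding x.

module Submission where

open import Defs
open import Data.Nat using (ℕ; zero; suc; _+_; _≤_; _⊔_; s≤s; s≤s⁻¹)
open import Data.Nat.Properties
  using (≤-trans; ≤-antisym; +-comm; suc-injective; <-cmp; n≤0⇒n≡0; n≢0⇒n>0;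
         1+n≰n; m≤m+n; m≤n+m; m≤m⊔n; m≤n⊔m)
open import Data.Bool using (Bool; not)
open import Data.Bool.Properties using (¬-not; not-¬)
open import Data.Unit using (tt)
open import Data.Empty using (⊥; ⊥-elim)
open import Data.Product using (Σ; _×_; _,_; proj₁; proj₂)
open import Data.Sum using (_⊎_; inj₁; inj₂)
open import Relation.Binary.Definitions using (tri<; tri≈; tri>)
open import Relation.Nullary using (¬_)
open import Relation.Nullary.Negation using (contradiction)
open import Relation.Binary.PropositionalEquality
  using (_≡_; _≢_; refl; sym; trans; cong; subst; subst₂; module ≡-Reasoning)

differ-by-one : ∀ {m n} → m ≤ suc n → n ≤ suc m → m ≢ n → m ≡ suc n ⊎ n ≡ suc m
differ-by-one {m} {n} m≤1+n n≤1+m m≢n with <-cmp m n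
... | tri< m<n _ _ = inj₂ (≤-antisym n≤1+m m<n)
... | tri≈ _ m≡n _ = contradiction m≡n m≢n
... | tri> _ _ n<m = inj₁ (≤-antisym m≤1+n n<m)

strictly-above : ∀ k n → ¬ (suc k + n ≤ n)
strictly-above k n le = 1+n≰n (≤-trans (s≤s (m≤n+m n k)) le)

≤max₁ : ∀ a b c e → a ≤ a ⊔ b ⊔ c ⊔ e
≤max₁ a b c e = ≤-trans (m≤m⊔n a b) (≤-trans (m≤m⊔n (a ⊔ b) c) (m≤m⊔n (a ⊔ b ⊔ c) e))

≤max₂ : ∀ a b c e → b ≤ a ⊔ b ⊔ c ⊔ e
≤max₂ a b c e = ≤-trans (m≤n⊔m a b) (≤-trans (m≤m⊔n (a ⊔ b) c) (m≤m⊔n (a ⊔ b ⊔ c) e))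

≤max₃ : ∀ a b c e → c ≤ a ⊔ b ⊔ c ⊔ e
≤max₃ a b c e = ≤-trans (m≤n⊔m (a ⊔ b) c) (m≤m⊔n (a ⊔ b ⊔ c) e)

≤max₄ : ∀ a b c e → e ≤ a ⊔ b ⊔ c ⊔ e
≤max₄ a b c e = m≤n⊔m (a ⊔ b ⊔ c) e

toggle : ℕ → Bool → Bool
toggle zero    b = b
toggle (suc k) b = not (toggle k b)

toggle-not : ∀ k b → toggle k (not b) ≡ not (toggle k b)
toggle-not zero    b = refl
toggle-not (suc k) b = cong not (toggle-not k b)

-- (d(z,p), d(z,q)) for z on the line through p, q with d(p,q) = 2:
-- z is the midpoint, lies beyond q, or lies beyond p.
data LinePair : ℕ → ℕ → Set where
  between : LinePair 1 1
  beyond₂ : ∀ n → LinePair (2 + n) n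
  beyond₁ : ∀ n → LinePair n (2 + n)

-- The shape of the line condition of the paper, with n = d(p,q),
-- a = d(p,z), b = d(z,q); InLine unfolds to exactly this.
Shape : ℕ → ℕ → ℕ → Set
Shape n a b = (n ≡ a + b) ⊎ (n + b ≡ a) ⊎ (n + a ≡ b)

sum-two : ∀ a b → 2 ≡ a + b → LinePair a b
sum-two 0 .2 refl = beyond₁ 0
sum-two 1 .1 refl = between
sum-two 2 0 refl = beyond₂ 0
sum-two 2 (suc _) ()
sum-two (suc (suc (suc _))) _ ()

from-shape : ∀ {a b} → Shape 2 a b → LinePair a b
from-shape {a} {b} (inj₁ e)        = sum-two a b e
from-shape {a} {b} (inj₂ (inj₁ e)) = subst (λ a → LinePair a b) e (beyond₂ b)
from-shape {a} {b} (inj₂ (inj₂ e)) = subst (LinePair a) e (beyond₁ a)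

to-shape : ∀ {a b} → LinePair a b → Shape 2 a b
to-shape between     = inj₁ refl
to-shape (beyond₂ n) = inj₂ (inj₁ refl)
to-shape (beyond₁ n) = inj₂ (inj₂ refl)

LinePair-swap : ∀ {a b} → LinePair a b → LinePair b a
LinePair-swap between     = between
LinePair-swap (beyond₂ n) = beyond₁ n
LinePair-swap (beyond₁ n) = beyond₂ n

LinePair-diagonal : ∀ {n} → LinePair n n → n ≡ 1
LinePair-diagonal between = refl

LinePair-lower : ∀ {j m} → LinePair (2 + j) m → m ≤ 2 + j → m ≡ j
LinePair-lower (beyond₂ n)           _  = refl
LinePair-lower {j} (beyond₁ .(2 + j)) le = contradiction le (strictly-above 1 (2 + j))

-- The configurations in which the theorem holds for arithmetic reasons:
-- one distance is four more than the opposite one.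
data Far : ℕ → ℕ → ℕ → ℕ → Set where
  far-yt : ∀ m → Far m (2 + m) (2 + m) (4 + m)
  far-xs : ∀ m → Far (4 + m) (2 + m) (2 + m) m
  far-xt : ∀ m → Far (2 + m) (4 + m) m (2 + m)
  far-ys : ∀ m → Far (2 + m) m (4 + m) (2 + m)

data Configuration : ℕ → ℕ → ℕ → ℕ → Set where
  far      : ∀ {xs xt ys yt} → Far xs xt ys yt → Configuration xs xt ys yt
  twins    : Configuration 1 1 1 1
  cut-yt   : Configuration 1 1 1 3
  cut-xs   : Configuration 3 1 1 1
  cut-xt   : Configuration 1 3 1 1
  cut-ys   : Configuration 1 1 3 1
  cross-xt : ∀ m → Configuration (2 + m) m m (2 + m)
  cross-xs : ∀ m → Configuration m (2 + m) (2 + m) m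

-- s and t on the line xy, x and y on the line st.
classify : ∀ {xs xt ys yt} → LinePair xs ys → LinePair xt yt →
           LinePair xs xt → LinePair ys yt → Configuration xs xt ys yt
classify between     between     between     between     = twins
classify between     (beyond₁ _) between     (beyond₁ _) = cut-yt
classify between     (beyond₂ _) (beyond₁ _) between     = cut-xt
classify (beyond₂ _) between     (beyond₂ _) between     = cut-xs
classify (beyond₁ _) between     between     (beyond₂ _) = cut-ys
classify (beyond₂ _) (beyond₂ m) (beyond₂ _) (beyond₂ _) = far (far-xs m)
classify (beyond₂ m) (beyond₂ _) (beyond₁ _) (beyond₁ _) = far (far-xt m)
classify (beyond₁ _) (beyond₁ _) (beyond₂ m) (beyond₂ _) = far (far-ys m)
classify (beyond₁ m) (beyond₁ _) (beyond₁ _) (beyond₁ _) = far (far-yt m)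
classify (beyond₂ m) (beyond₁ _) (beyond₂ _) (beyond₁ _) = cross-xt m
classify (beyond₁ m) (beyond₂ _) (beyond₁ _) (beyond₂ _) = cross-xs m

-- The theorem in a far configuration, with d(y,x) = d(s,t) = 2 substituted
-- into [yxst].
far-conclusion : ∀ {xs xt ys yt} → Far xs xt ys yt →
  (4 ≤ xs ⊔ xt ⊔ ys ⊔ yt) ×
  (yt ≡ xs ⊔ xt ⊔ ys ⊔ yt → yt ≡ 2 + xt × yt ≡ 2 + xs + 2 × yt ≡ ys + 2)
far-conclusion (far-yt m) =
  ≤-trans (m≤m+n 4 m) (≤max₄ m (2 + m) (2 + m) (4 + m)) ,
  λ _ → refl , cong (2 +_) (+-comm 2 m) , cong (2 +_) (+-comm 2 m)
far-conclusion (far-xs m) =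
  ≤-trans (m≤m+n 4 m) xs≤max ,
  λ yt≡max → contradiction (subst (4 + m ≤_) (sym yt≡max) xs≤max) (strictly-above 3 m)
  where xs≤max : 4 + m ≤ (4 + m) ⊔ (2 + m) ⊔ (2 + m) ⊔ m
        xs≤max = ≤max₁ (4 + m) (2 + m) (2 + m) m
far-conclusion (far-xt m) =
  ≤-trans (m≤m+n 4 m) xt≤max ,
  λ yt≡max → contradiction (subst (4 + m ≤_) (sym yt≡max) xt≤max) (strictly-above 1 (2 + m))
  where xt≤max : 4 + m ≤ (2 + m) ⊔ (4 + m) ⊔ m ⊔ (2 + m)
        xt≤max = ≤max₂ (2 + m) (4 + m) m (2 + m)
far-conclusion (far-ys m) =
  ≤-trans (m≤m+n 4 m) ys≤max ,
  λ yt≡max → contradiction (subst (4 + m ≤_) (sym yt≡max) ys≤max) (strictly-above 1 (2 + m))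
  where ys≤max : 4 + m ≤ (2 + m) ⊔ m ⊔ (4 + m) ⊔ (2 + m)
        ys≤max = ≤max₃ (2 + m) m (4 + m) (2 + m)

module Walks (G : Graph) where
  open Graph G using () renaming (sym to adj-sym)

  _++ʷ_ : ∀ {x y z k l} → Walk G x y k → Walk G y z l → Walk G x z (k + l)
  here _     ++ʷ w = w
  step _ a v ++ʷ w = step tt a (v ++ʷ w)

  reverseʷ : ∀ {x y k} → Walk G x y k → Walk G y x k
  reverseʷ (here _) = here tt
  reverseʷ {k = suc k} (step _ a w) =
    subst (Walk G _ _) (+-comm k 1) (reverseʷ w ++ʷ step tt (adj-sym a) (here tt))

module Metric {G : Graph} {d : V G → V G → ℕ} (dist : IsDistance G d) where
  open Graph G using (Adj; irrefl)
  open Walks G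

  geodesic : ∀ x y → Walk G x y (d x y)
  geodesic x y = proj₁ (dist x y)

  shortest : ∀ {x y k} → Walk G x y k → d x y ≤ k
  shortest {x} {y} {k} = proj₂ (dist x y) k

  d-sym : ∀ x y → d x y ≡ d y x
  d-sym x y = ≤-antisym (shortest (reverseʷ (geodesic y x))) (shortest (reverseʷ (geodesic x y)))

  triangle : ∀ x y z → d x z ≤ d x y + d y z
  triangle x y z = shortest (geodesic x y ++ʷ geodesic y z)

  d-self : ∀ x → d x x ≡ 0
  d-self x = n≤0⇒n≡0 (shortest (here tt))

  d-zero : ∀ {x y} → d x y ≡ 0 → x ≡ y
  d-zero {x} {y} e = endpoints (subst (Walk G x y) e (geodesic x y))
    where
      endpoints : ∀ {x y} → Walk G x y 0 → x ≡ y
      endpoints (here _) = refl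

  adjacent : ∀ {x y} → Adj x y → d x y ≡ 1
  adjacent {x} {y} a =
    ≤-antisym (shortest (step tt a (here tt)))
              (n≢0⇒n>0 (λ e → irrefl (subst (Adj x) (sym (d-zero e)) a)))

  unit-source : ∀ {p q} → d p q ≡ 1 → ∀ r → d q r ≤ suc (d p r)
  unit-source {p} {q} e r =
    subst (d q r ≤_) (cong (_+ d p r) (trans (d-sym q p) e)) (triangle q p r)

  unit-target : ∀ {p q} → d p q ≡ 1 → ∀ r → d r q ≤ suc (d r p)
  unit-target {p} {q} e r =
    subst (d r q ≤_) (trans (cong (d r p +_) e) (+-comm (d r p) 1)) (triangle r p q)

  towards : ∀ {x y k} → d x y ≡ suc k → Σ (V G) λ v → d x v ≡ 1 × d v y ≡ k
  towards {x} {y} {k} e with subst (Walk G x y) e (geodesic x y)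
  ... | step {y = v} _ a w =
    v , adjacent a ,
    ≤-antisym (shortest w) (s≤s⁻¹ (subst (_≤ suc (d v y)) e (shortest (step tt a (geodesic v y)))))

  closer-source : ∀ {v w r k} → d v w ≡ 1 → d w r ≡ suc k → d v r ≤ k → d v r ≡ k
  closer-source {v} {w} {r} vw wr le =
    ≤-antisym le (s≤s⁻¹ (subst (_≤ suc (d v r)) wr (unit-source vw r)))

  closer-target : ∀ {p q r k} → d q p ≡ 1 → d r p ≡ suc k → d r q ≤ k → d r q ≡ k
  closer-target {p} {q} {r} qp rp le =
    ≤-antisym le (s≤s⁻¹ (subst (_≤ suc (d r q)) rp (unit-target qp r)))

  via-middle : ∀ {p m q u} → d p m ≡ 1 → d m q ≡ 1 → d u q ≡ 2 + d u p → d u m ≡ suc (d u p)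
  via-middle {p} {m} {q} {u} pm mq uq =
    ≤-antisym (unit-target pm u) (s≤s⁻¹ (subst (_≤ suc (d u m)) uq (unit-target mq u)))

  Line : V G → V G → V G → Set
  Line p q z = LinePair (d z p) (d z q)

  line-ends : ∀ {p q z} → Line p q z → LinePair (d p z) (d q z)
  line-ends {p} {q} {z} = subst₂ LinePair (d-sym z p) (d-sym z q)

  line⇐InLine : ∀ {p q z} → d p q ≡ 2 → InLine G d p q z → Line p q z
  line⇐InLine {p} {q} {z} e h =
    subst (λ a → LinePair a (d z q)) (d-sym p z)
          (from-shape (subst (λ n → Shape n (d p z) (d z q)) e h))

  InLine⇐line : ∀ {p q z} → d p q ≡ 2 → Line p q z → InLine G d p q z
  InLine⇐line {p} {q} {z} e h =
    subst (λ n → Shape n (d p z) (d z q)) (sym e)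
          (to-shape (subst (λ a → LinePair a (d z q)) (d-sym z p) h))

  first-on-line : ∀ {p q} → d p q ≡ 2 → Line p q p
  first-on-line {p} {q} e = subst₂ LinePair (sym (d-self p)) (sym e) (beyond₁ 0)

  second-on-line : ∀ {p q} → d p q ≡ 2 → Line p q q
  second-on-line {p} {q} e =
    subst₂ LinePair (sym (trans (d-sym q p) e)) (sym (d-self q)) (beyond₂ 0)

  Coline : V G → V G → V G → V G → Set
  Coline x y s t = ∀ z → (Line x y z → Line s t z) × (Line s t z → Line x y z)

  coline : ∀ {x y s t} → d x y ≡ 2 → d s t ≡ 2 → SameLine G d x y s t → Coline x y s t
  coline xy st same z =
    (λ h → line⇐InLine st (proj₁ (same z) (InLine⇐line xy h))) ,
    (λ h → line⇐InLine xy (proj₂ (same z) (InLine⇐line st h)))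

  coline-swap₁ : ∀ {x y s t} → Coline x y s t → Coline y x s t
  coline-swap₁ L z = (λ h → proj₁ (L z) (LinePair-swap h)) , (λ h → LinePair-swap (proj₂ (L z) h))

  coline-swap₂ : ∀ {x y s t} → Coline x y s t → Coline x y t s
  coline-swap₂ L z = (λ h → LinePair-swap (proj₁ (L z) h)) , (λ h → proj₂ (L z) (LinePair-swap h))

module Parity {G : Graph} {d : V G → V G → ℕ} (dist : IsDistance G d) (bip : Bipartite G) where
  open Metric dist

  colour : V G → Bool
  colour = proj₁ bip

  colour-walk : ∀ {x z k} → Walk G x z k → colour z ≡ toggle k (colour x)
  colour-walk (here _) = refl
  colour-walk {k = suc k} (step _ a w) =
    trans (colour-walk w)
          (trans (cong (toggle k) (¬-not (λ e → proj₂ bip a (sym e)))) (toggle-not k _))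

  unit-step : ∀ {p q} → d p q ≡ 1 → ∀ r → d r q ≡ suc (d r p) ⊎ d r p ≡ suc (d r q)
  unit-step {p} {q} e r =
    differ-by-one (unit-target e r) (unit-target (trans (d-sym q p) e) r) parity
    where
      open ≡-Reasoning
      c : Bool
      c = colour r
      q-colour : colour q ≡ not (colour p)
      q-colour = subst (λ k → colour q ≡ toggle k (colour p)) e (colour-walk (geodesic p q))
      parity : d r q ≢ d r p
      parity eq = not-¬ refl (begin
        toggle (d r p) c       ≡⟨ cong (λ k → toggle k c) (sym eq) ⟩
        toggle (d r q) c       ≡⟨ sym (colour-walk (geodesic r q)) ⟩
        colour q               ≡⟨ q-colour ⟩
        not (colour p)         ≡⟨ cong not (colour-walk (geodesic r p)) ⟩
        not (toggle (d r p) c) ∎)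

  unit-step-source : ∀ {p q} → d p q ≡ 1 → ∀ r → d q r ≡ suc (d p r) ⊎ d p r ≡ suc (d q r)
  unit-step-source {p} {q} e r rewrite d-sym q r | d-sym p r = unit-step e r

  two-apart : ∀ {p q} → d p q ≡ 2 → ∀ r →
              d r p ≡ d r q ⊎ d r q ≡ 2 + d r p ⊎ d r p ≡ 2 + d r q
  two-apart e r with towards e
  ... | v , pv , vq with unit-step pv r | unit-step vq r
  ... | inj₁ v+ | inj₁ q+ = inj₂ (inj₁ (trans q+ (cong suc v+)))
  ... | inj₁ v+ | inj₂ v- = inj₁ (suc-injective (trans (sym v+) v-))
  ... | inj₂ p+ | inj₁ q+ = inj₁ (trans p+ (sym q+))
  ... | inj₂ p+ | inj₂ v- = inj₂ (inj₂ (trans p+ (cong suc v-)))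

  -- A vertex equidistant from x and y, at a distance other than 1, is off
  -- the common line; hence it is equidistant from s and t, at distance ≠ 1.
  off-line : ∀ {x y s t w n} → d s t ≡ 2 → Coline x y s t →
             d w x ≡ n → d w y ≡ n → n ≢ 1 → d w s ≡ d w t × d w s ≢ 1
  off-line {x} {y} {s} {t} {w} st L wx wy n≢1 =
    equal , λ ws → off (subst₂ LinePair (sym ws) (sym (trans (sym equal) ws)) between)
    where
      off : ¬ Line s t w
      off h = n≢1 (LinePair-diagonal (subst₂ LinePair wx wy (proj₂ (L w) h)))
      equal : d w s ≡ d w t
      equal with two-apart st w
      ... | inj₁ e        = e
      ... | inj₂ (inj₁ e) = contradiction (subst (LinePair (d w s)) (sym e) (beyond₁ (d w s))) off
      ... | inj₂ (inj₂ e) = contradiction (subst (λ a → LinePair a (d w t)) (sym e) (beyond₂ (d w t))) off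

  near-x : ∀ {x y s t u} → Coline x y s t →
           d x s ≡ 1 → d x t ≡ 1 → d y s ≡ 1 → d y t ≡ 1 → d u y ≡ 2 + d u x → u ≡ x
  near-x {x} {y} {s} {t} {u} L xs xt ys yt uy =
    d-zero (suc-injective (LinePair-diagonal (subst₂ LinePair us ut (proj₁ (L u) on-xy))))
    where
      on-xy : Line x y u
      on-xy = subst (LinePair (d u x)) (sym uy) (beyond₁ (d u x))
      us : d u s ≡ suc (d u x)
      us = via-middle xs (trans (d-sym s y) ys) uy
      ut : d u t ≡ suc (d u x)
      ut = via-middle xt (trans (d-sym t y) yt) uy

  common-neighbours⇒twins : ∀ {x y s t} → d x y ≡ 2 → Coline x y s t →
    d x s ≡ 1 → d x t ≡ 1 → d y s ≡ 1 → d y t ≡ 1 → IsTwins G d x y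
  common-neighbours⇒twins {x} {y} xy L xs xt ys yt = x≢y , x≁y , equidistant
    where
      x≢y : x ≢ y
      x≢y e = contradiction (trans (sym (d-self x)) (subst (λ z → d x z ≡ 2) (sym e) xy)) λ ()
      x≁y : d x y ≢ 1
      x≁y e = contradiction (trans (sym xy) e) λ ()
      equidistant : ∀ u → u ≢ x → u ≢ y → d x u ≡ d y u
      equidistant u u≢x u≢y with two-apart xy u
      ... | inj₁ e        = trans (d-sym x u) (trans e (d-sym u y))
      ... | inj₂ (inj₁ e) = contradiction (near-x L xs xt ys yt e) u≢x
      ... | inj₂ (inj₂ e) = contradiction (near-x (coline-swap₁ L) ys yt xs xt e) u≢y

  -- The crossed configuration (d(x,s), d(x,t), d(y,s), d(y,t)) = (2+m, m, m, 2+m)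
  -- forces m = 0, i.e. x = t and y = s: the midpoint of x and y is on the
  -- common line, at distance m+1 from both s and t.
  crossed : ∀ {x y s t m} → d x y ≡ 2 → Coline x y s t →
            d x s ≡ 2 + m → d x t ≡ m → d y s ≡ m → d y t ≡ 2 + m → x ≡ t × y ≡ s
  crossed {x} {y} {s} {t} {m} xy L xs xt ys yt with towards xy
  ... | v , xv , vy = d-zero (trans xt m≡0) , d-zero (trans ys m≡0)
    where
      vx : d v x ≡ 1
      vx = trans (d-sym v x) xv
      midpoint : Line x y v
      midpoint = subst₂ LinePair (sym vx) (sym vy) between
      s-side : d s x ≡ 2 + d s y
      s-side = trans (d-sym s x) (trans xs (cong (2 +_) (sym (trans (d-sym s y) ys))))
      t-side : d t y ≡ 2 + d t x
      t-side = trans (d-sym t y) (trans yt (cong (2 +_) (sym (trans (d-sym t x) xt))))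
      vs : d v s ≡ suc m
      vs = trans (d-sym v s)
                 (trans (via-middle (trans (d-sym y v) vy) vx s-side) (cong suc (trans (d-sym s y) ys)))
      vt : d v t ≡ suc m
      vt = trans (d-sym v t)
                 (trans (via-middle xv vy t-side) (cong suc (trans (d-sym t x) xt)))
      m≡0 : m ≡ 0
      m≡0 = suc-injective (LinePair-diagonal (subst₂ LinePair vs vt (proj₁ (L v) midpoint)))

  module CutVertex {x y s t : V G} (st : d s t ≡ 2) (L : Coline x y s t)
                   (xs : d x s ≡ 1) (xt : d x t ≡ 1) (ys : d y s ≡ 1) (yt : d y t ≡ 3) where

    sx : d s x ≡ 1
    sx = trans (d-sym s x) xs

    sy : d s y ≡ 1
    sy = trans (d-sym s y) ys

    tx : d t x ≡ 1
    tx = trans (d-sym t x) xt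

    -- No vertex is at distance j+1 from s and j+2 from both x and y: walking
    -- towards s keeps this shape (using off-line) until distance 1 from s,
    -- which off-line forbids.
    descent : ∀ j w → d w s ≡ suc j → d w x ≡ 2 + j → d w y ≡ 2 + j → ⊥
    descent zero w ws wx wy = proj₂ (off-line st L wx wy λ ()) ws
    descent (suc j) w ws wx wy with towards ws
    ... | v , wv , vs = descent j v vs vx vy
      where
        vw : d v w ≡ 1
        vw = trans (d-sym v w) wv
        vx : d v x ≡ 2 + j
        vx = closer-source vw wx (subst (λ k → d v x ≤ suc k) vs (unit-target sx v))
        vy : d v y ≡ 2 + j
        vy = closer-source vw wy (subst (λ k → d v y ≤ suc k) vs (unit-target sy v))

    -- Along an edge u w, leaving the region d(·,y) = d(·,x) + 2 by getting one
    -- farther from x and one closer to y leads to a vertex excluded by descent.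
    no-crossing : ∀ {u w} j → d u x ≡ suc j → d u y ≡ 3 + j → d u w ≡ 1 →
                  d w x ≡ 2 + j → d w y ≡ 2 + j → ⊥
    no-crossing {u} {w} j ux uy uw wx wy = descent j w ws wx wy
      where
        us : d u s ≡ 2 + j
        us = trans (via-middle xs sy (trans uy (cong (2 +_) (sym ux)))) (cong suc ux)
        on-st : Line s t u
        on-st = proj₁ (L u) (subst₂ LinePair (sym ux) (sym uy) (beyond₁ (suc j)))
        ut : d u t ≡ j
        ut = LinePair-lower (subst (λ a → LinePair a (d u t)) us on-st)
                            (subst (λ k → d u t ≤ suc k) ux (unit-target xt u))
        wt : d w t ≡ suc j
        wt = closer-target tx wx (subst (λ k → d w t ≤ suc k) ut (unit-source uw t))
        ws : d w s ≡ suc j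
        ws = trans (proj₁ (off-line st L wx wy λ ())) wt

    preserved : ∀ {u w} → u ≢ x → d u w ≡ 1 → d u y ≡ 2 + d u x → d w y ≡ 2 + d w x
    preserved {u} {w} u≢x uw inv with unit-step-source uw x | unit-step-source uw y
    ... | inj₁ wx | inj₁ wy = trans wy (trans (cong suc inv) (cong (2 +_) (sym wx)))
    ... | inj₂ ux | inj₂ uy = suc-injective (trans (sym uy) (trans inv (cong (2 +_) ux)))
    ... | inj₂ ux | inj₁ wy =
      contradiction (subst (_≤ 2 + d w x) (trans wy (trans (cong suc inv) (cong (3 +_) ux))) via-s)
                    (strictly-above 1 (2 + d w x))
      where
        via-s : d w y ≤ 2 + d w x
        via-s = ≤-trans (unit-target sy w) (s≤s (unit-target xs w))
    ... | inj₁ wx | inj₂ uy = ⊥-elim (crossing (d u x) refl)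
      where
        crossing : ∀ k → d u x ≡ k → ⊥
        crossing zero    ux = u≢x (d-zero ux)
        crossing (suc j) ux =
          no-crossing j ux uy′ uw (trans wx (cong suc ux)) (suc-injective (trans (sym uy) uy′))
          where
            uy′ : d u y ≡ 3 + j
            uy′ = trans inv (cong (2 +_) ux)

    -- Hence a path from a vertex with the invariant cannot reach y, whose
    -- distance to y is 0.
    never-reaches-y : ∀ {u k} → WalkIn G (λ w → w ≢ x) u y k → d u y ≡ 2 + d u x → ⊥
    never-reaches-y (here _)         inv = contradiction (trans (sym (d-self y)) inv) λ ()
    never-reaches-y (step u≢x a walk) inv = never-reaches-y walk (preserved u≢x (adjacent a) inv)

    -- The invariant holds at t, so every path from t to y meets x.
    not-two-connected : ¬ TwoConnected G
    not-two-connected (_ , _ , avoiding) =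
      never-reaches-y (proj₂ (avoiding x t y t≢x y≢x))
                      (trans (d-sym t y) (trans yt (cong (2 +_) (sym tx))))
      where
        t≢x : t ≢ x
        t≢x e = contradiction (trans (sym (d-self x)) (subst (λ z → d x z ≡ 1) e xt)) λ ()
        y≢x : y ≢ x
        y≢x e = contradiction (trans (sym (subst (λ z → d z t ≡ 3) e yt)) xt) λ ()

  nondegenerate : ∀ {x y s t} → TwoConnected G → NoTwins G d →
    ¬ ((x ≡ s × y ≡ t) ⊎ (x ≡ t × y ≡ s)) →
    d x y ≡ 2 → d s t ≡ 2 → Coline x y s t →
    ∀ {xs xt ys yt} → Configuration xs xt ys yt →
    d x s ≡ xs → d x t ≡ xt → d y s ≡ ys → d y t ≡ yt → Far xs xt ys yt
  nondegenerate {x} {y} {s} {t} two-connected no-twins distinct xy st L = cases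
    where
      yx : d y x ≡ 2
      yx = trans (d-sym y x) xy
      ts : d t s ≡ 2
      ts = trans (d-sym t s) st
      cases : ∀ {xs xt ys yt} → Configuration xs xt ys yt →
              d x s ≡ xs → d x t ≡ xt → d y s ≡ ys → d y t ≡ yt → Far xs xt ys yt
      cases (far f) _ _ _ _ = f
      cases twins xs xt ys yt = ⊥-elim (no-twins x y (common-neighbours⇒twins xy L xs xt ys yt))
      cases cut-yt xs xt ys yt =
        ⊥-elim (CutVertex.not-two-connected st L xs xt ys yt two-connected)
      cases cut-xs xs xt ys yt =
        ⊥-elim (CutVertex.not-two-connected ts (coline-swap₁ (coline-swap₂ L)) yt ys xt xs two-connected)
      cases cut-xt xs xt ys yt =
        ⊥-elim (CutVertex.not-two-connected st (coline-swap₁ L) ys yt xs xt two-connected)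
      cases cut-ys xs xt ys yt =
        ⊥-elim (CutVertex.not-two-connected ts (coline-swap₂ L) xt xs yt ys two-connected)
      cases (cross-xt _) xs xt ys yt = ⊥-elim (distinct (inj₂ (crossed xy L xs xt ys yt)))
      cases (cross-xs _) xs xt ys yt with crossed yx (coline-swap₁ L) ys yt xs xt
      ... | y≡t , x≡s = ⊥-elim (distinct (inj₁ (x≡s , y≡t)))

between-from : ∀ {G : Graph} {d : V G → V G → ℕ} {x y s t : V G} →
  d y x ≡ 2 → d s t ≡ 2 →
  d y t ≡ 2 + d x t × d y t ≡ 2 + d x s + 2 × d y t ≡ d y s + 2 → Between4 G d y x s t
between-from yx st identities rewrite yx | st = identities

lemma4 : (G : Graph) (d : V G → V G → ℕ) → IsDistance G d →
         TwoConnected G → Bipartite G → NoTwins G d →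
         (x y s t : V G) →
         ¬ ((x ≡ s × y ≡ t) ⊎ (x ≡ t × y ≡ s)) →
         d x y ≡ 2 → d s t ≡ 2 → SameLine G d x y s t →
         (4 ≤ (d x s ⊔ d x t ⊔ d y s ⊔ d y t)) ×
         (d y t ≡ (d x s ⊔ d x t ⊔ d y s ⊔ d y t) → Between4 G d y x s t)
lemma4 G d dist two-connected bip no-twins x y s t distinct xy st same =
  proj₁ (far-conclusion far-configuration) ,
  λ yt-max → between-from {G} {d} {x} (trans (d-sym y x) xy) st
                          (proj₂ (far-conclusion far-configuration) yt-max)
  where
    open Metric dist
    open Parity dist bip
    L : Coline x y s t
    L = coline xy st same
    configuration : Configuration (d x s) (d x t) (d y s) (d y t)
    configuration =
      classify (line-ends (proj₂ (L s) (first-on-line st)))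
               (line-ends (proj₂ (L t) (second-on-line st)))
               (proj₁ (L x) (first-on-line xy))
               (proj₁ (L y) (second-on-line xy))
    far-configuration : Far (d x s) (d x t) (d y s) (d y t)
    far-configuration =
      nondegenerate two-connected no-twins distinct xy st L configuration refl refl refl refl
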